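{- An element $w\in B_n$ avoids the signed patterns $1\bar2$ and $\bar21$ if and only if the set of negative letters in $w_1\cdots w_n$ is empty or equals $\{\bar b,\dots,\bar1\}$ for some $b\ge1$.
   Context: $[\bar n,n]=\{ -n,\dots,-1,1,\dots,n\}$, $\bar a=-a$. $B_n$ is the group of permutations $w$ of $[\bar n,n]$ with $w(\bar i)=\overline{w(i)}$; $w_i=w(i)$. Signed patterns: for a word $v_1\cdots v_k$ in $[\bar k,k]$ with $|v_1|\cdots|v_k|$ a permutation of $[k]$, a word $y_1\cdots y_k$ in $[\bar n,n]$ with distinct absolute values matches $v$ if $v_i,y_i$ have the same sign for all $i$ and $|v_i|<|v_j|\iff|y_i|<|y_j|$; $w$ avoids $v$ if no subsequence of $w_1\cdots w_n$ matches $v$. -}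

module Defs where

open import Data.Nat using (ℕ)
open import Data.Integer using (ℤ; +_; -_; ∣_∣; _<_; _≤_; 0ℤ)
import Data.Nat as ℕ
open import Data.Fin using (Fin)
import Data.Fin as F
open import Data.Product using (Σ; ∃; _×_; _,_)
open import Data.Sum using (_⊎_)
open import Relation.Nullary using (¬_)
open import Relation.Binary.PropositionalEquality using (_≡_)
open import Function.Bundles using (_⇔_)

-- An element w of B_n, recorded by its one-line notation w_1 ⋯ w_n
-- (w(ī) = -w(i) determines the rest): each letter is a nonzero integer
-- in [n̄,n] and the absolute values are pairwise distinct (so |w_1|⋯|w_n|
-- is a permutation of [n]).
record B (n : ℕ) : Set where
  field
    word     : Fin n → ℤ
    absRange : ∀ i → 1 ℕ.≤ ∣ word i ∣ × ∣ word i ∣ ℕ.≤ n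
    absInj   : ∀ i j → ∣ word i ∣ ≡ ∣ word j ∣ → i ≡ j
open B public

SameSign : ℤ → ℤ → Set
SameSign a b = (0ℤ < a × 0ℤ < b) ⊎ (a < 0ℤ × b < 0ℤ)

Occurrence : {n k : ℕ} → (Fin n → ℤ) → (Fin k → ℤ) → Set
Occurrence {n} {k} y v =
  Σ (Fin k → Fin n) λ f →
    (∀ a b → a F.< b → f a F.< f b) ×
    (∀ a → SameSign (v a) (y (f a))) ×
    (∀ a b → (∣ v a ∣ ℕ.< ∣ v b ∣) ⇔ (∣ y (f a) ∣ ℕ.< ∣ y (f b) ∣))

Avoids : {n k : ℕ} → B n → (Fin k → ℤ) → Set
Avoids w v = ¬ Occurrence (word w) v

pat-1-2̄ : Fin 2 → ℤ
pat-1-2̄ F.zero = + 1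
pat-1-2̄ (F.suc F.zero) = - (+ 2)

pat-2̄-1 : Fin 2 → ℤ
pat-2̄-1 F.zero = - (+ 2)
pat-2̄-1 (F.suc F.zero) = + 1

NegLetter : {n : ℕ} → B n → ℤ → Set
NegLetter w x = (∃ λ i → word w i ≡ x) × x < 0ℤ

-- A pair of letters of opposite signs in which the negative one is larger in absolute
-- value is an occurrence of 1 2̄ or of 2̄ 1, according to which of the two comes first.
-- So w avoids both patterns iff every negative letter is smaller in absolute value than
-- every positive one. As ∣w₁∣ ⋯ ∣wₙ∣ is a permutation of [n], this says that the negative
-- letters are exactly b̄, …, 1̄, where b is the largest absolute value of a negative letter.

module Submission where

open import Defs
open import Data.Nat using (ℕ; zero; suc; z≤n; s≤s)
import Data.Nat as ℕ
import Data.Nat.Properties as ℕP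
open import Data.Integer using (ℤ; +_; -_; -[1+_]; ∣_∣; 0ℤ; _≤_; _<_; -≤-; -<+; +<+)
import Data.Integer.Properties as ℤP
open import Data.Fin using (Fin; fromℕ<; punchOut)
import Data.Fin as F
import Data.Fin.Properties as FP
open import Data.Fin.Patterns using (0F; 1F)
open import Data.Product using (Σ; ∃; _×_; _,_; proj₁; proj₂; map₂)
open import Data.Sum using (_⊎_; inj₁; inj₂)
import Data.Sum as Sum
open import Relation.Nullary using (¬_; yes; no; contradiction)
open import Relation.Binary using (tri<; tri≈; tri>)
open import Relation.Binary.PropositionalEquality
  using (_≡_; _≢_; refl; sym; trans; cong; subst; subst₂)
open import Function.Base using (_∘_)
open import Function.Definitions using (Injective)
open import Function.Bundles using (_⇔_; mk⇔; Equivalence)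
open import Function.Properties.Equivalence using () renaming (trans to ⇔-trans; sym to ⇔-sym)

nonzero⇒neg⊎pos : ∀ x → 1 ℕ.≤ ∣ x ∣ → x < 0ℤ ⊎ 0ℤ < x
nonzero⇒neg⊎pos (+ zero)  ()
nonzero⇒neg⊎pos (+ suc _) _ = inj₂ (+<+ (s≤s z≤n))
nonzero⇒neg⊎pos -[1+ _ ]  _ = inj₁ -<+

neg-∣∣-injective : ∀ {x y} → x < 0ℤ → y < 0ℤ → ∣ x ∣ ≡ ∣ y ∣ → x ≡ y
neg-∣∣-injective { -[1+ _ ]} { -[1+ _ ]} _ _ refl = refl
neg-∣∣-injective {+ _} (+<+ ()) _ _
neg-∣∣-injective { -[1+ _ ]} {+ _} _ (+<+ ()) _

neg-interval⇔ : ∀ b x → (- (+ b) ≤ x × x ≤ - (+ 1)) ⇔ (x < 0ℤ × ∣ x ∣ ℕ.≤ b)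
neg-interval⇔ b x = mk⇔ (to b x) (from b x)
  where
  to : ∀ b x → - (+ b) ≤ x × x ≤ - (+ 1) → x < 0ℤ × ∣ x ∣ ℕ.≤ b
  to (suc b) -[1+ _ ] (-≤- k≤b , _) = -<+ , s≤s k≤b
  to zero    -[1+ _ ] (() , _)
  to _       (+ _)    (_ , ())
  from : ∀ b x → x < 0ℤ × ∣ x ∣ ℕ.≤ b → - (+ b) ≤ x × x ≤ - (+ 1)
  from (suc b) -[1+ _ ] (_ , s≤s k≤b) = -≤- k≤b , -≤- z≤n
  from _       (+ _)    (+<+ () , _)

neg⇒1≤∣∣ : ∀ {x} → x < 0ℤ → 1 ℕ.≤ ∣ x ∣
neg⇒1≤∣∣ { -[1+ _ ]} _ = s≤s z≤n
neg⇒1≤∣∣ {+ _} (+<+ ())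

∣_∣⁻ : ℤ → ℕ
∣ + _ ∣⁻      = 0
∣ -[1+ k ] ∣⁻ = suc k

∣∣⁻-neg : ∀ {x} → x < 0ℤ → ∣ x ∣⁻ ≡ ∣ x ∣
∣∣⁻-neg { -[1+ _ ]} _ = refl
∣∣⁻-neg {+ _} (+<+ ())

∣∣⁻≡suc⇒ : ∀ {x m} → ∣ x ∣⁻ ≡ suc m → x ≡ -[1+ m ]
∣∣⁻≡suc⇒ { -[1+ _ ]} refl = refl

sameSign-neg : ∀ {a b} → SameSign a b → a < 0ℤ → b < 0ℤ
sameSign-neg (inj₁ (0<a , _)) a<0 = contradiction 0<a (ℤP.<-asym a<0)
sameSign-neg (inj₂ (_ , b<0)) _   = b<0

sameSign-pos : ∀ {a b} → SameSign a b → 0ℤ < a → 0ℤ < b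
sameSign-pos (inj₁ (_ , 0<b)) _   = 0<b
sameSign-pos (inj₂ (a<0 , _)) 0<a = contradiction 0<a (ℤP.<-asym a<0)

injective⇒surjective : ∀ {n} (f : Fin n → Fin n) → Injective _≡_ _≡_ f →
                       ∀ t → ∃ λ i → f i ≡ t
injective⇒surjective {suc n} f f-inj t with FP.any? (λ i → f i FP.≟ t)
... | yes hit = hit
... | no miss = contradiction (f-inj (FP.punchOut-injective (t≢f i) (t≢f j) pᵢ≡pⱼ))
                              (FP.<⇒≢ i<j)
  where
  t≢f : ∀ i → t ≢ f i
  t≢f i t≡fi = miss (i , sym t≡fi)
  -- punching t out of the image squeezes n + 1 values into Fin n
  collision = FP.pigeonhole (ℕP.n<1+n n) (λ i → punchOut (t≢f i))
  i = proj₁ collision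
  j = proj₁ (proj₂ collision)
  i<j = proj₁ (proj₂ (proj₂ collision))
  pᵢ≡pⱼ = proj₂ (proj₂ (proj₂ collision))

injective-into-[1,n]⇒onto : ∀ {n} (a : Fin n → ℕ) → (∀ i → 1 ℕ.≤ a i × a i ℕ.≤ n) →
                             Injective _≡_ _≡_ a → ∀ m → 1 ℕ.≤ m → m ℕ.≤ n → ∃ λ i → a i ≡ m
injective-into-[1,n]⇒onto {n} a a-range a-inj m 1≤m m≤n =
  map₂ (λ eq → pred-injective′ (proj₁ (a-range _)) 1≤m (fromℕ<-injective′ eq))
       (injective⇒surjective index index-injective (fromℕ< (pred<n 1≤m m≤n)))
  where
  pred<n : ∀ {k} → 1 ℕ.≤ k → k ℕ.≤ n → ℕ.pred k ℕ.< n
  pred<n {suc _} _ k≤n = k≤n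
  pred-injective′ : ∀ {k l} → 1 ℕ.≤ k → 1 ℕ.≤ l → ℕ.pred k ≡ ℕ.pred l → k ≡ l
  pred-injective′ {suc _} {suc _} _ _ = cong suc
  fromℕ<-injective′ : ∀ {k l} .{k<n : k ℕ.< n} .{l<n : l ℕ.< n} →
                      fromℕ< k<n ≡ fromℕ< l<n → k ≡ l
  fromℕ<-injective′ = FP.fromℕ<-injective _ _ _ _
  index : Fin n → Fin n
  index i = fromℕ< (pred<n (proj₁ (a-range i)) (proj₂ (a-range i)))
  index-injective : Injective _≡_ _≡_ index
  index-injective eq =
    a-inj (pred-injective′ (proj₁ (a-range _)) (proj₁ (a-range _)) (fromℕ<-injective′ eq))

maximum : ∀ {n} (f : Fin n → ℕ) → ∃ λ M → (∀ i → f i ℕ.≤ M) × (M ≡ 0 ⊎ ∃ λ i → f i ≡ M)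
maximum {zero} f = 0 , (λ ()) , inj₁ refl
maximum {suc n} f with maximum (f ∘ F.suc)
... | M , bound , attained with f F.zero ℕ.≤? M
...   | yes f₀≤M = M , bound′ , Sum.map₂ (λ (i , eq) → F.suc i , eq) attained
  where
  bound′ : ∀ i → f i ℕ.≤ M
  bound′ F.zero    = f₀≤M
  bound′ (F.suc i) = bound i
...   | no f₀≰M = f F.zero , bound′ , inj₂ (F.zero , refl)
  where
  bound′ : ∀ i → f i ℕ.≤ f F.zero
  bound′ F.zero    = ℕP.≤-refl
  bound′ (F.suc i) = ℕP.≤-trans (bound i) (ℕP.<⇒≤ (ℕP.≰⇒> f₀≰M))

both⇔ : ∀ {a b} {A : Set a} {B : Set b} → A → B → A ⇔ B
both⇔ a b = mk⇔ (λ _ → b) (λ _ → a)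

neither⇔ : ∀ {a b} {A : Set a} {B : Set b} → ¬ A → ¬ B → A ⇔ B
neither⇔ ¬a ¬b = mk⇔ (λ a → contradiction a ¬a) (λ b → contradiction b ¬b)

pair-occurrence : ∀ {n} (y : Fin n → ℤ) (v : Fin 2 → ℤ) {i j : Fin n} → i F.< j →
                  SameSign (v 0F) (y i) → SameSign (v 1F) (y j) →
                  (∣ v 0F ∣ ℕ.< ∣ v 1F ∣ ⇔ ∣ y i ∣ ℕ.< ∣ y j ∣) →
                  (∣ v 1F ∣ ℕ.< ∣ v 0F ∣ ⇔ ∣ y j ∣ ℕ.< ∣ y i ∣) →
                  Occurrence y v
pair-occurrence {n} y v {i} {j} i<j sign₀ sign₁ order₀₁ order₁₀ = f , monotone , signs , order
  where
  f : Fin 2 → Fin n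
  f 0F = i
  f 1F = j
  monotone : ∀ a b → a F.< b → f a F.< f b
  monotone 0F 1F _ = i<j
  monotone 0F 0F ()
  monotone 1F 0F ()
  monotone 1F 1F (s≤s ())
  signs : ∀ a → SameSign (v a) (y (f a))
  signs 0F = sign₀
  signs 1F = sign₁
  order : ∀ a b → (∣ v a ∣ ℕ.< ∣ v b ∣) ⇔ (∣ y (f a) ∣ ℕ.< ∣ y (f b) ∣)
  order 0F 0F = neither⇔ (ℕP.<-irrefl refl) (ℕP.<-irrefl refl)
  order 1F 1F = neither⇔ (ℕP.<-irrefl refl) (ℕP.<-irrefl refl)
  order 0F 1F = order₀₁
  order 1F 0F = order₁₀

module _ {n : ℕ} (w : B n) where

  private
    y : Fin n → ℤ
    y = word w

  absolute-values-onto : ∀ m → 1 ℕ.≤ m → m ℕ.≤ n → ∃ λ i → ∣ y i ∣ ≡ m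
  absolute-values-onto = injective-into-[1,n]⇒onto (∣_∣ ∘ y) (absRange w) (λ {i} {j} → absInj w i j)

  NegBelowPos : Set
  NegBelowPos = ∀ i j → y i < 0ℤ → 0ℤ < y j → ∣ y i ∣ ℕ.< ∣ y j ∣

  negBelowPos⇒avoids : NegBelowPos → ∀ {k} (v : Fin k → ℤ) a b →
                       v a < 0ℤ → 0ℤ < v b → ∣ v b ∣ ℕ.< ∣ v a ∣ → Avoids w v
  negBelowPos⇒avoids below v a b va<0 0<vb vb<va (f , _ , signs , order) =
    ℕP.<-asym (below (f a) (f b) (sameSign-neg (signs a) va<0) (sameSign-pos (signs b) 0<vb))
              (Equivalence.to (order b a) vb<va)

  occurrence-1-2̄ : ∀ {i j} → i F.< j → 0ℤ < y i → y j < 0ℤ → ∣ y i ∣ ℕ.< ∣ y j ∣ →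
                   Occurrence y pat-1-2̄
  occurrence-1-2̄ i<j 0<yi yj<0 yi<yj =
    pair-occurrence y pat-1-2̄ i<j (inj₁ (+<+ (s≤s z≤n) , 0<yi)) (inj₂ (-<+ , yj<0))
      (both⇔ (s≤s (s≤s z≤n)) yi<yj) (neither⇔ (λ { (s≤s ()) }) (ℕP.<-asym yi<yj))

  occurrence-2̄-1 : ∀ {i j} → i F.< j → y i < 0ℤ → 0ℤ < y j → ∣ y j ∣ ℕ.< ∣ y i ∣ →
                   Occurrence y pat-2̄-1
  occurrence-2̄-1 i<j yi<0 0<yj yj<yi =
    pair-occurrence y pat-2̄-1 i<j (inj₂ (-<+ , yi<0)) (inj₁ (+<+ (s≤s z≤n) , 0<yj))
      (neither⇔ (λ { (s≤s ()) }) (ℕP.<-asym yj<yi)) (both⇔ (s≤s (s≤s z≤n)) yj<yi)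

  opposite-signs⇒abs-≢ : ∀ {i j} → y i < 0ℤ → 0ℤ < y j → ∣ y i ∣ ≢ ∣ y j ∣
  opposite-signs⇒abs-≢ {i} {j} yi<0 0<yj eq with absInj w i j eq
  ... | refl = ℤP.<-asym yi<0 0<yj

  avoids⇒negBelowPos : Avoids w pat-1-2̄ → Avoids w pat-2̄-1 → NegBelowPos
  avoids⇒negBelowPos avoids-1-2̄ avoids-2̄-1 i j yi<0 0<yj with ∣ y i ∣ ℕ.<? ∣ y j ∣
  ... | yes yi<yj = yi<yj
  ... | no yi≮yj
    with FP.<-cmp i j | ℕP.≤∧≢⇒< (ℕP.≮⇒≥ yi≮yj) (opposite-signs⇒abs-≢ yi<0 0<yj ∘ sym)
  ... | tri< i<j _ _  | yj<yi = contradiction (occurrence-2̄-1 i<j yi<0 0<yj yj<yi) avoids-2̄-1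
  ... | tri≈ _ refl _ | _     = contradiction 0<yj (ℤP.<-asym yi<0)
  ... | tri> _ _ j<i  | yj<yi = contradiction (occurrence-1-2̄ j<i 0<yj yi<0 yj<yi) avoids-1-2̄

  NegLettersDownTo : ℕ → Set
  NegLettersDownTo b = ∀ x → NegLetter w x ⇔ (- (+ b) ≤ x × x ≤ - (+ 1))

  noNegatives⇒negBelowPos : (∀ x → ¬ NegLetter w x) → NegBelowPos
  noNegatives⇒negBelowPos none i _ yi<0 _ = contradiction ((i , refl) , yi<0) (none (y i))

  negLettersDownTo⇒negBelowPos : ∀ b → NegLettersDownTo b → NegBelowPos
  negLettersDownTo⇒negBelowPos b negatives i j yi<0 0<yj =
    ℕP.≤-<-trans yi≤b (ℕP.≰⇒> yj≰b)
    where
    yi≤b : ∣ y i ∣ ℕ.≤ b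
    yi≤b = proj₂ (Equivalence.to (⇔-trans (negatives (y i)) (neg-interval⇔ b (y i)))
                                 ((i , refl) , yi<0))
    -- otherwise - y j would be a letter, whose absolute value forces it to sit at position j
    yj≰b : ¬ ∣ y j ∣ ℕ.≤ b
    yj≰b yj≤b with Equivalence.from (⇔-trans (negatives (- y j)) (neg-interval⇔ b (- y j)))
                     (ℤP.neg-mono-< 0<yj , subst (ℕ._≤ b) (sym (ℤP.∣-i∣≡∣i∣ (y j))) yj≤b)
    ... | (k , yk≡-yj) , -yj<0 with absInj w k j (trans (cong ∣_∣ yk≡-yj) (ℤP.∣-i∣≡∣i∣ (y j)))
    ...   | refl = ℤP.<-asym 0<yj (subst (_< 0ℤ) (sym yk≡-yj) -yj<0)

  negBelowPos⇒negLettersDownTo : NegBelowPos →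
                                 (∀ x → ¬ NegLetter w x) ⊎ ∃ λ b → 1 ℕ.≤ b × NegLettersDownTo b
  negBelowPos⇒negLettersDownTo below with maximum (∣_∣⁻ ∘ y)
  ... | zero , bound , _ = inj₁ none
    where
    none : ∀ x → ¬ NegLetter w x
    none _ ((i , refl) , yi<0) =
      ℕP.<⇒≱ (proj₁ (absRange w i)) (subst (ℕ._≤ 0) (∣∣⁻-neg yi<0) (bound i))
  ... | suc m , bound , inj₂ (i₀ , ∣yi₀∣⁻≡1+m) =
    inj₂ (suc m , s≤s z≤n , λ x → ⇔-trans (mk⇔ (to x) (from x)) (⇔-sym (neg-interval⇔ (suc m) x)))
    where
    yi₀<0 : y i₀ < 0ℤ
    yi₀<0 = subst (_< 0ℤ) (sym (∣∣⁻≡suc⇒ ∣yi₀∣⁻≡1+m)) -<+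
    ∣yi₀∣≡1+m : ∣ y i₀ ∣ ≡ suc m
    ∣yi₀∣≡1+m = trans (sym (∣∣⁻-neg yi₀<0)) ∣yi₀∣⁻≡1+m
    to : ∀ x → NegLetter w x → x < 0ℤ × ∣ x ∣ ℕ.≤ suc m
    to _ ((i , refl) , yi<0) = yi<0 , subst (ℕ._≤ suc m) (∣∣⁻-neg yi<0) (bound i)
    from : ∀ x → x < 0ℤ × ∣ x ∣ ℕ.≤ suc m → NegLetter w x
    from x (x<0 , x≤1+m)
      with i , yi≡x ← absolute-values-onto ∣ x ∣ (neg⇒1≤∣∣ x<0)
                        (ℕP.≤-trans x≤1+m (subst (ℕ._≤ n) ∣yi₀∣≡1+m (proj₂ (absRange w i₀))))
      with nonzero⇒neg⊎pos (y i) (proj₁ (absRange w i))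
    ... | inj₁ yi<0 = (i , neg-∣∣-injective yi<0 x<0 yi≡x) , x<0
    ... | inj₂ 0<yi = contradiction (below i₀ i yi₀<0 0<yi)
                        (ℕP.≤⇒≯ (subst₂ ℕ._≤_ (sym yi≡x) (sym ∣yi₀∣≡1+m) x≤1+m))

lemma2p2 : (n : ℕ) (w : B n) →
    (Avoids w pat-1-2̄ × Avoids w pat-2̄-1) ⇔
    ((∀ x → ¬ NegLetter w x) ⊎
    Σ ℕ (λ b → 1 ℕ.≤ b × (∀ x → NegLetter w x ⇔ (- (+ b) ≤ x × x ≤ - (+ 1)))))
lemma2p2 n w = mk⇔
  (λ (avoids-1-2̄ , avoids-2̄-1) →
     negBelowPos⇒negLettersDownTo w (avoids⇒negBelowPos w avoids-1-2̄ avoids-2̄-1))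
  (λ negLetters →
     let below = Sum.[ noNegatives⇒negBelowPos w
                     , (λ (b , _ , downTo) → negLettersDownTo⇒negBelowPos w b downTo) ] negLetters
     -- in both patterns the negative letter 2̄ exceeds the positive letter 1
     in negBelowPos⇒avoids w below pat-1-2̄ 1F 0F -<+ (+<+ (s≤s z≤n)) (s≤s (s≤s z≤n))
      , negBelowPos⇒avoids w below pat-2̄-1 0F 1F -<+ (+<+ (s≤s z≤n)) (s≤s (s≤s z≤n)))
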